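{- Let $\mathcal E$ be a finitely complete category equipped with a cloven weak factorisation system. Then there is a type category whose category of contexts is $\mathcal E$ and whose collection of types over $\Gamma\in\mathcal E$ is the set of cloven $\mathcal R$-maps with codomain $\Gamma$ (for a type $(x,p)\colon X\to\Gamma$, the extended context is $X$ and the dependent projection is $x$).
   Context: A cloven w.f.s. on $\mathcal E$ consists of: for each $f\colon X\to Y$ a factorisation $f=\rho_f\lambda_f$ through $Pf$; for each commutative square $gh=kf$ a map $P(h,k)\colon Pf\to Pg$ with $P(h,k)\lambda_f=\lambda_gh$, $\rho_gP(h,k)=k\rho_f$, functorial in $(h,k)$; and fillers $\sigma_f\colon Pf\to P\lambda_f$, $\pi_f\colon P\rho_f\to Pf$ with $\sigma_f\lambda_f=\lambda_{\lambda_f}$, $\rho_{\lambda_f}\sigma_f=1$, $\pi_f\lambda_{\rho_f}=1$, $\rho_f\pi_f=\rho_{\rho_f}$. A cloven $\mathcal R$-map $(f,p)$ is $f\colon X\to Y$ with $p\colon Pf\to X$, $p\lambda_f=1_X$, $fp=\rho_f$. A type category consists of a category $\mathcal C$ of contexts; for each $\Gamma$ a collection $\mathrm{Ty}(\Gamma)$; for each $A\in\mathrm{Ty}(\Gamma)$ an object $\Gamma.A$ and a morphism $\pi_A\colon\Gamma.A\to\Gamma$; and for each $f\colon\Delta\to\Gamma$ and $A\in\mathrm{Ty}(\Gamma)$ a type $A[f]\in\mathrm{Ty}(\Delta)$ and a morphism $f^+\colon\Delta.A[f]\to\Gamma.A$ such that $\pi_Af^+=f\pi_{A[f]}$ is a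 pullback square. (Strict functoriality of substitution is not required.) -}

module Defs where

open import Level using (Level; _⊔_; suc)
open import Relation.Binary.PropositionalEquality using (_≡_)
open import Data.Product using (Σ; Σ-syntax; _×_; _,_; proj₁; proj₂)

record Category (o ℓ : Level) : Set (suc (o ⊔ ℓ)) where
  infixr 9 _∘_
  field
    Obj  : Set o
    Hom  : Obj → Obj → Set ℓ
    id   : ∀ {A} → Hom A A
    _∘_  : ∀ {A B C} → Hom B C → Hom A B → Hom A C
    identityˡ : ∀ {A B} {f : Hom A B} → id ∘ f ≡ f
    identityʳ : ∀ {A B} {f : Hom A B} → f ∘ id ≡ f
    assoc     : ∀ {A B C D} {f : Hom A B} {g : Hom B C} {h : Hom C D} →
                (h ∘ g) ∘ f ≡ h ∘ (g ∘ f)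

module _ {o ℓ : Level} (𝒞 : Category o ℓ) where
  open Category 𝒞

  record IsPullback {P A B C : Obj} (p₁ : Hom P A) (p₂ : Hom P B)
                    (f : Hom A C) (g : Hom B C) : Set (o ⊔ ℓ) where
    field
      commute   : f ∘ p₁ ≡ g ∘ p₂
      universal : ∀ {W} (u : Hom W A) (v : Hom W B) → f ∘ u ≡ g ∘ v → Hom W P
      universal-p₁ : ∀ {W} {u : Hom W A} {v : Hom W B} (eq : f ∘ u ≡ g ∘ v) →
                     p₁ ∘ universal u v eq ≡ u
      universal-p₂ : ∀ {W} {u : Hom W A} {v : Hom W B} (eq : f ∘ u ≡ g ∘ v) →
                     p₂ ∘ universal u v eq ≡ v
      unique    : ∀ {W} {u : Hom W A} {v : Hom W B} (eq : f ∘ u ≡ g ∘ v)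
                  (w : Hom W P) → p₁ ∘ w ≡ u → p₂ ∘ w ≡ v →
                  w ≡ universal u v eq

  record Pullback {A B C : Obj} (f : Hom A C) (g : Hom B C) : Set (o ⊔ ℓ) where
    field
      {P}  : Obj
      p₁   : Hom P A
      p₂   : Hom P B
      isPullback : IsPullback p₁ p₂ f g

  record IsTerminal (T : Obj) : Set (o ⊔ ℓ) where
    field
      ! : ∀ {A} → Hom A T
      !-unique : ∀ {A} (h : Hom A T) → h ≡ !

  record FinitelyComplete : Set (o ⊔ ℓ) where
    field
      ⊤ : Obj
      ⊤-isTerminal : IsTerminal ⊤
      pullback : ∀ {A B C} (f : Hom A C) (g : Hom B C) → Pullback f g

  record ClovenWFS : Set (o ⊔ ℓ) where
    field
      Pt : ∀ {X Y} → Hom X Y → Obj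
      λ' : ∀ {X Y} (f : Hom X Y) → Hom X (Pt f)
      ρ  : ∀ {X Y} (f : Hom X Y) → Hom (Pt f) Y
      factor : ∀ {X Y} (f : Hom X Y) → ρ f ∘ λ' f ≡ f
      P₁ : ∀ {X Y X' Y'} {f : Hom X Y} {g : Hom X' Y'}
           (h : Hom X X') (k : Hom Y Y') → g ∘ h ≡ k ∘ f → Hom (Pt f) (Pt g)
      P₁-λ : ∀ {X Y X' Y'} {f : Hom X Y} {g : Hom X' Y'}
             (h : Hom X X') (k : Hom Y Y') (sq : g ∘ h ≡ k ∘ f) →
             P₁ h k sq ∘ λ' f ≡ λ' g ∘ h
      P₁-ρ : ∀ {X Y X' Y'} {f : Hom X Y} {g : Hom X' Y'}
             (h : Hom X X') (k : Hom Y Y') (sq : g ∘ h ≡ k ∘ f) →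
             ρ g ∘ P₁ h k sq ≡ k ∘ ρ f
      P₁-id : ∀ {X Y} {f : Hom X Y} (sq : f ∘ id ≡ id ∘ f) → P₁ id id sq ≡ id
      P₁-∘ : ∀ {X Y X' Y' X'' Y''} {f : Hom X Y} {g : Hom X' Y'} {e : Hom X'' Y''}
             (h : Hom X X') (k : Hom Y Y') (h' : Hom X' X'') (k' : Hom Y' Y'')
             (sq : g ∘ h ≡ k ∘ f) (sq' : e ∘ h' ≡ k' ∘ g)
             (sq'' : e ∘ (h' ∘ h) ≡ (k' ∘ k) ∘ f) →
             P₁ (h' ∘ h) (k' ∘ k) sq'' ≡ P₁ h' k' sq' ∘ P₁ h k sq
      σ : ∀ {X Y} (f : Hom X Y) → Hom (Pt f) (Pt (λ' f))
      π : ∀ {X Y} (f : Hom X Y) → Hom (Pt (ρ f)) (Pt f)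
      σ-λ : ∀ {X Y} (f : Hom X Y) → σ f ∘ λ' f ≡ λ' (λ' f)
      ρ-σ : ∀ {X Y} (f : Hom X Y) → ρ (λ' f) ∘ σ f ≡ id
      π-λ : ∀ {X Y} (f : Hom X Y) → π f ∘ λ' (ρ f) ≡ id
      ρ-π : ∀ {X Y} (f : Hom X Y) → ρ f ∘ π f ≡ ρ (ρ f)

  module _ (W : ClovenWFS) where
    open ClovenWFS W

    record RStructure {X Y : Obj} (f : Hom X Y) : Set ℓ where
      field
        p    : Hom (Pt f) X
        p-λ  : p ∘ λ' f ≡ id
        f-p  : f ∘ p ≡ ρ f

    record RMapOver (Γ : Obj) : Set (o ⊔ ℓ) where
      constructor rmap
      field
        {dom}  : Obj
        map    : Hom dom Γ
        rstr   : RStructure map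

  -- A type category with category of contexts 𝒞, given collections of types
  -- Ty, context extension ext (Γ.A) and dependent projections proj (π_A).
  -- (Substitution need not be strictly functorial.)
  record TypeCategoryOn {t : Level} (Ty : Obj → Set t)
                        (ext : ∀ {Γ} → Ty Γ → Obj)
                        (proj : ∀ {Γ} (A : Ty Γ) → Hom (ext A) Γ)
                        : Set (o ⊔ ℓ ⊔ t) where
    field
      _[_] : ∀ {Δ Γ} → Ty Γ → Hom Δ Γ → Ty Δ
      _⁺   : ∀ {Δ Γ} {A : Ty Γ} (f : Hom Δ Γ) → Hom (ext (A [ f ])) (ext A)
      isPullback : ∀ {Δ Γ} (A : Ty Γ) (f : Hom Δ Γ) →
                   IsPullback (_⁺ {A = A} f) (proj (A [ f ])) (proj A) f

  record TypeCategory (t : Level) : Set (o ⊔ ℓ ⊔ suc t) where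
    field
      Ty   : Obj → Set t
      ext  : ∀ {Γ} → Ty Γ → Obj
      proj : ∀ {Γ} (A : Ty Γ) → Hom (ext A) Γ
      structure : TypeCategoryOn Ty ext proj

module Submission where

-- Substitution of (x, p) along f : Δ → Γ is
-- the chosen pullback p₂ : P → Δ of x along f, with f⁺ = p₁; the pullback
-- condition then holds by construction.  The only content is therefore that
-- cloven R-maps are stable under pullback:
--   * an endomorphism of a pullback object commuting with both projections
--     is the identity (`pullback-endo-id`);
--   * given a pullback square of x along f and an R-structure p on x, the map
--     Pt p₂ → Pt x → X obtained from the square p₂ ⇒ x and p, paired with
--     ρ p₂, factors through P and is an R-structure on p₂ (`pullback-RStructure`).

open import Level using (Level)
open import Defs
open import Relation.Binary.PropositionalEquality using (_≡_; sym; trans; cong; module ≡-Reasoning)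

module _ {o ℓ : Level} (𝓔 : Category o ℓ) where
  open Category 𝓔
  open ≡-Reasoning

  pullback-endo-id : ∀ {P A B C} {p₁ : Hom P A} {p₂ : Hom P B} {f : Hom A C} {g : Hom B C}
                     (pb : IsPullback 𝓔 p₁ p₂ f g) (e : Hom P P) →
                     p₁ ∘ e ≡ p₁ → p₂ ∘ e ≡ p₂ → e ≡ id
  pullback-endo-id pb e e-p₁ e-p₂ =
    trans (unique commute e e-p₁ e-p₂) (sym (unique commute id identityʳ identityʳ))
    where open IsPullback pb

  module _ (W : ClovenWFS 𝓔) where
    open ClovenWFS W

    pullback-RStructure : ∀ {P X Δ Γ} {p₁ : Hom P X} {p₂ : Hom P Δ} {x : Hom X Γ} {f : Hom Δ Γ} →
                          IsPullback 𝓔 p₁ p₂ x f → RStructure 𝓔 W x → RStructure 𝓔 W p₂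
    pullback-RStructure {P} {p₁ = p₁} {p₂} {x} {f} pb rx = record
      { p   = lift
      ; p-λ = pullback-endo-id pb (lift ∘ λ' p₂) lift-λ-p₁ lift-λ-p₂
      ; f-p = universal-p₂ lift-commutes
      }
      where
        open IsPullback pb
        open RStructure rx

        Pt-square : Hom (Pt p₂) (Pt x)
        Pt-square = P₁ p₁ f commute

        lift-commutes : x ∘ (p ∘ Pt-square) ≡ f ∘ ρ p₂
        lift-commutes = begin
          x ∘ (p ∘ Pt-square) ≡⟨ sym assoc ⟩
          (x ∘ p) ∘ Pt-square ≡⟨ cong (_∘ Pt-square) f-p ⟩
          ρ x ∘ Pt-square     ≡⟨ P₁-ρ p₁ f commute ⟩
          f ∘ ρ p₂            ∎

        lift : Hom (Pt p₂) P
        lift = universal (p ∘ Pt-square) (ρ p₂) lift-commutes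

        lift-λ-p₁ : p₁ ∘ (lift ∘ λ' p₂) ≡ p₁
        lift-λ-p₁ = begin
          p₁ ∘ (lift ∘ λ' p₂)       ≡⟨ sym assoc ⟩
          (p₁ ∘ lift) ∘ λ' p₂       ≡⟨ cong (_∘ λ' p₂) (universal-p₁ lift-commutes) ⟩
          (p ∘ Pt-square) ∘ λ' p₂   ≡⟨ assoc ⟩
          p ∘ (Pt-square ∘ λ' p₂)   ≡⟨ cong (p ∘_) (P₁-λ p₁ f commute) ⟩
          p ∘ (λ' x ∘ p₁)           ≡⟨ sym assoc ⟩
          (p ∘ λ' x) ∘ p₁           ≡⟨ cong (_∘ p₁) p-λ ⟩
          id ∘ p₁                   ≡⟨ identityˡ ⟩
          p₁                        ∎

        lift-λ-p₂ : p₂ ∘ (lift ∘ λ' p₂) ≡ p₂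
        lift-λ-p₂ = begin
          p₂ ∘ (lift ∘ λ' p₂)  ≡⟨ sym assoc ⟩
          (p₂ ∘ lift) ∘ λ' p₂  ≡⟨ cong (_∘ λ' p₂) (universal-p₂ lift-commutes) ⟩
          ρ p₂ ∘ λ' p₂         ≡⟨ factor p₂ ⟩
          p₂                   ∎

proposition3p10 : {o ℓ : Level} (𝓔 : Category o ℓ) → FinitelyComplete 𝓔 → (W : ClovenWFS 𝓔) → TypeCategoryOn 𝓔 (RMapOver 𝓔 W) (λ A → RMapOver.dom A) (λ A → RMapOver.map A)
proposition3p10 𝓔 fc W = record
  { _[_]       = λ A f → rmap (Pullback.p₂ (chosen A f))
                              (pullback-RStructure 𝓔 W (Pullback.isPullback (chosen A f)) (RMapOver.rstr A))
  ; _⁺         = λ {A = A} f → Pullback.p₁ (chosen A f)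
  ; isPullback = λ A f → Pullback.isPullback (chosen A f)
  }
  where
    open Category 𝓔 using (Hom)

    chosen : ∀ {Δ Γ} (A : RMapOver 𝓔 W Γ) (f : Hom Δ Γ) → Pullback 𝓔 (RMapOver.map A) f
    chosen A f = FinitelyComplete.pullback fc (RMapOver.map A) f
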